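{- Let $G=(V,E)$ be an undirected graph and $S\subseteq V$. Let $Z\subseteq V$ be an $S$-strong region, and let $Y\subseteq V$ satisfy $Y\subseteq\mathcal{P}_S$ and $ext(Y)\subseteq S$. Then $Z\setminus Y$ is an $S$-strong region.
   Context: For an undirected graph $G=(V,E)$ and $S\subseteq V$, $\mathcal{P}_S$ is obtained by (Rule 1) putting every node of $S$ and every neighbor of a node of $S$ into $\mathcal{P}_S$, and (Rule 2) repeatedly: if $v\in\mathcal{P}_S$ and all neighbors of $v$ except exactly one neighbor $w$ are in $\mathcal{P}_S$, insert $w$. For $R\subseteq V$, $nbr(R)=\{v\in V\setminus R: v \text{ is adjacent to some } u\in R\}$ and $ext(R)=nbr(V\setminus R)$ (the nodes of $R$ adjacent to some node of $V\setminus R$). A set $R$ is an $S$-strong region if $R\not\subseteq\mathcal{P}_{S\cup nbr(R)}$; otherwise $R$ is an $S$-weak region. -}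

module Defs where

open import Data.Nat using (ℕ)
open import Data.Bool using (Bool; true; false; not; _∧_)
open import Data.Fin using (Fin)
open import Data.Fin.Properties using (any?)
open import Data.Fin.Subset using (Subset; _∈_; _∉_; _∪_; _─_; ∁)
open import Data.Fin.Subset.Properties using (_∈?_)
open import Data.Vec using (tabulate)
open import Data.Product using (_×_; ∃)
open import Relation.Nullary using (¬_; Dec; yes; no)
open import Relation.Nullary.Decidable using (⌊_⌋; _×-dec_)
open import Relation.Binary.PropositionalEquality using (_≡_; _≢_)
open import Data.Bool.Properties using () renaming (_≟_ to _≟B_)

record Graph (n : ℕ) : Set where
  field
    adj    : Fin n → Fin n → Bool
    sym    : ∀ u v → adj u v ≡ adj v u
    irrefl : ∀ v → adj v v ≡ false
open Graph public

module _ {n : ℕ} (G : Graph n) where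

  Adj : Fin n → Fin n → Set
  Adj u v = adj G u v ≡ true

  nbr : Subset n → Subset n
  nbr R = tabulate λ v →
    ⌊ (v ∈? ∁ R) ×-dec any? (λ u → (u ∈? R) ×-dec (adj G u v ≟B true)) ⌋

  ext : Subset n → Subset n
  ext R = nbr (∁ R)

  data 𝒫 (S : Subset n) : Fin n → Set where
    rule1-self : ∀ {v} → v ∈ S → 𝒫 S v
    rule1-nbr  : ∀ {u v} → u ∈ S → Adj u v → 𝒫 S v
    rule2      : ∀ {v w} → 𝒫 S v → Adj v w →
                 (∀ x → Adj v x → x ≢ w → 𝒫 S x) → 𝒫 S w

  _⊆𝒫_ : Subset n → Subset n → Set
  R ⊆𝒫 S = ∀ {v} → v ∈ R → 𝒫 S v

  Strong : Subset n → Subset n → Set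
  Strong S R = ¬ (R ⊆𝒫 (S ∪ nbr R))

  Weak : Subset n → Subset n → Set
  Weak S R = R ⊆𝒫 (S ∪ nbr R)

-- Removing Y from Z can create new neighbours only inside Y, namely nodes of Y
-- adjacent to Z ∖ Y, and those lie in ext(Y) ⊆ S; hence
-- S ∪ nbr(Z ∖ Y) ⊆ S ∪ nbr(Z).  By monotonicity of 𝒫 in its seed set, if
-- Z ∖ Y were weak then Z ∖ Y ⊆ 𝒫_{S ∪ nbr(Z)}, and Y ⊆ 𝒫_S ⊆ 𝒫_{S ∪ nbr(Z)}
-- as well, so Z itself would be weak.
module Submission where

open import Data.Nat using (ℕ)
open import Data.Fin using (Fin)
open import Data.Fin.Subset using (Subset; _⊆_; _─_; _∈_; _∉_; _∪_; ∁; inside; outside)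
open import Data.Fin.Subset.Properties
  using (_∈?_; x∈∁p⇒x∉p; x∉p⇒x∈∁p; x∈p⇒x∉∁p; p⊆p∪q; q⊆p∪q; x∈p∪q⁻; p─q⊆p; x∈p∧x∉q⇒x∈p─q)
open import Data.Vec using (_∷_; tabulate; here; there)
open import Data.Vec.Properties using (lookup∘tabulate; []=⇒lookup; lookup⇒[]=)
open import Data.Bool.Properties using (T-≡)
open import Data.Product using (_×_; _,_; ∃)
open import Data.Sum using (inj₁; inj₂; [_,_])
open import Function using (_∘_)
open import Function.Bundles using (_⇔_; mk⇔; Equivalence)
open import Relation.Nullary using (yes; no; contradiction)
open import Relation.Nullary.Decidable using (⌊_⌋; toWitness; fromWitness)
open import Relation.Unary using (Pred; Decidable)
open import Relation.Binary.PropositionalEquality using (trans) renaming (sym to ≡-sym)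
open import Defs

x∈p─q⇒x∉q : ∀ {n} {p q : Subset n} {x} → x ∈ p ─ q → x ∉ q
x∈p─q⇒x∉q {p = inside ∷ _} {outside ∷ _} here      ()
x∈p─q⇒x∉q {p = _ ∷ p}      {_ ∷ q}       (there m) (there x∈q) = x∈p─q⇒x∉q {p = p} {q} m x∈q

x∈tabulate⌊P?⌋⇔P : ∀ {n ℓ} {P : Pred (Fin n) ℓ} (P? : Decidable P) {x} →
                   x ∈ tabulate (λ y → ⌊ P? y ⌋) ⇔ P x
x∈tabulate⌊P?⌋⇔P P? {x} = mk⇔
  (λ x∈ → toWitness (Equivalence.from T-≡
            (trans (≡-sym (lookup∘tabulate _ x)) ([]=⇒lookup x∈))))
  (λ Px → lookup⇒[]= x _
            (trans (lookup∘tabulate _ x) (Equivalence.to T-≡ (fromWitness Px))))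

module _ {n : ℕ} (G : Graph n) where

  x∈nbr⁻ : ∀ {R v} → v ∈ nbr G R → (v ∉ R) × ∃ λ u → (u ∈ R) × Adj G u v
  x∈nbr⁻ v∈ with Equivalence.to (x∈tabulate⌊P?⌋⇔P _) v∈
  ... | v∈∁R , adjacent = x∈∁p⇒x∉p v∈∁R , adjacent

  x∈nbr⁺ : ∀ {R u v} → v ∉ R → u ∈ R → Adj G u v → v ∈ nbr G R
  x∈nbr⁺ v∉R u∈R uv = Equivalence.from (x∈tabulate⌊P?⌋⇔P _) (x∉p⇒x∈∁p v∉R , _ , u∈R , uv)

  𝒫-mono : ∀ {S S'} → S ⊆ S' → ∀ {v} → 𝒫 G S v → 𝒫 G S' v
  𝒫-mono S⊆S' (rule1-self v∈S)   = rule1-self (S⊆S' v∈S)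
  𝒫-mono S⊆S' (rule1-nbr u∈S uv) = rule1-nbr (S⊆S' u∈S) uv
  𝒫-mono S⊆S' (rule2 p vw rest)  = rule2 (𝒫-mono S⊆S' p) vw (λ x vx x≢w → 𝒫-mono S⊆S' (rest x vx x≢w))

  nbr─⊆nbr∪ext : ∀ Z Y → nbr G (Z ─ Y) ⊆ nbr G Z ∪ ext G Y
  nbr─⊆nbr∪ext Z Y {w} w∈ with x∈nbr⁻ w∈
  ... | w∉Z─Y , u , u∈Z─Y , uw with w ∈? Z
  ...   | no w∉Z  = p⊆p∪q _ (x∈nbr⁺ w∉Z (p─q⊆p Z Y u∈Z─Y) uw)
  ...   | yes w∈Z with w ∈? Y
  ...     | no w∉Y  = contradiction (x∈p∧x∉q⇒x∈p─q w∈Z w∉Y) w∉Z─Y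
  ...     | yes w∈Y = q⊆p∪q _ _ (x∈nbr⁺ (x∈p⇒x∉∁p w∈Y) (x∉p⇒x∈∁p (x∈p─q⇒x∉q {p = Z} u∈Z─Y)) uw)

  weak─⇒weak : ∀ S Z Y → _⊆𝒫_ G Y S → ext G Y ⊆ S → Weak G S (Z ─ Y) → Weak G S Z
  weak─⇒weak S Z Y Y⊆𝒫S extY⊆S weak {v} v∈Z with v ∈? Y
  ... | yes v∈Y = 𝒫-mono (p⊆p∪q _) (Y⊆𝒫S v∈Y)
  ... | no v∉Y  = 𝒫-mono seeds⊆ (weak (x∈p∧x∉q⇒x∈p─q v∈Z v∉Y))
    where
    seeds⊆ : S ∪ nbr G (Z ─ Y) ⊆ S ∪ nbr G Z
    seeds⊆ x∈ with x∈p∪q⁻ S _ x∈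
    ... | inj₁ x∈S = p⊆p∪q _ x∈S
    ... | inj₂ x∈nbr = [ q⊆p∪q S _ , p⊆p∪q _ ∘ extY⊆S ] (x∈p∪q⁻ _ _ (nbr─⊆nbr∪ext Z Y x∈nbr))

lemma4 : ∀ {n : ℕ} (G : Graph n) (S Z Y : Subset n) →
         Strong G S Z →
         _⊆𝒫_ G Y S →
         ext G Y ⊆ S →
         Strong G S (Z ─ Y)
lemma4 G S Z Y strong Y⊆𝒫S extY⊆S = strong ∘ weak─⇒weak G S Z Y Y⊆𝒫S extY⊆S
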